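{- Let $k\ge 3$ and let $T_k$ be the graph obtained from the star $K_{1,2k}$ with center $u$ and leaves $v_1,\dots,v_{2k}$ by adding a new vertex $x$ and the edges $xv_i$ for $i\in[k]$. Then $\mathrm{gp}_{\rm d}(T_k)=k$ and $\mathrm{gp}_{\rm d}(T_k-x)=2k$.
   Context: All graphs are finite and simple. For a graph $G$ and $Z\subseteq V(G)$, two vertices $p,q\in V(G)$ are $Z$-positionable if no shortest $p,q$-path in $G$ has an internal vertex in $Z$. $Z$ is a dual general position set if every two vertices of $Z$ are $Z$-positionable and every two vertices of $V(G)\setminus Z$ are $Z$-positionable. $\mathrm{gp}_{\rm d}(G)$ is the maximum cardinality of a dual general position set of $G$. $G-x$ is the graph obtained by deleting $x$ and its incident edges; $[m]=\{1,\dots,m\}$. -}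

module Defs where

open import Data.Nat using (ℕ; zero; suc; _+_; _*_; _≤_; _<_; s≤s; z≤n)
open import Data.Nat.Properties using (<-irrefl; ≤-trans; n<1+n; m≤m+n; ≤-<-trans)
open import Data.Fin using (Fin; toℕ; fromℕ; punchIn)
open import Data.Fin.Subset using (Subset; _∈_; _∉_; ∣_∣)
open import Data.List using (List; []; _∷_)
open import Data.List.Relation.Unary.All using (All)
open import Data.Product using (Σ; _×_; _,_)
open import Data.Sum using (_⊎_; inj₁; inj₂)
open import Relation.Binary.PropositionalEquality using (_≡_; refl; sym; trans; subst)
open import Relation.Nullary using (¬_)
open import Data.Empty using (⊥)

record Graph (n : ℕ) : Set₁ where
  field
    Adj   : Fin n → Fin n → Set
    adj-sym : ∀ {u v} → Adj u v → Adj v u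
    adj-irrefl : ∀ {u} → ¬ Adj u u
open Graph public

data Walk {n : ℕ} (G : Graph n) : Fin n → Fin n → Set where
  here : ∀ {p} → Walk G p p
  step : ∀ {p r q} → Adj G p r → Walk G r q → Walk G p q

len : ∀ {n} {G : Graph n} {p q} → Walk G p q → ℕ
len here = 0
len (step _ w) = suc (len w)

inner : ∀ {n} {G : Graph n} {p q} → Walk G p q → List (Fin n)
inner here = []
inner (step _ here) = []
inner (step {r = r} _ (step a w)) = r ∷ inner (step a w)

-- a shortest p,q-path: a p,q-walk of minimum length (such walks are paths)
IsShortest : ∀ {n} {G : Graph n} {p q} → Walk G p q → Set
IsShortest {G = G} {p} {q} w = (w' : Walk G p q) → len w ≤ len w'

Positionable : ∀ {n} (G : Graph n) (Z : Subset n) (p q : Fin n) → Set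
Positionable G Z p q =
  (w : Walk G p q) → IsShortest w → All (λ v → v ∉ Z) (inner w)

IsDualGP : ∀ {n} (G : Graph n) (Z : Subset n) → Set
IsDualGP G Z =
  (∀ p q → p ∈ Z → q ∈ Z → Positionable G Z p q) ×
  (∀ p q → p ∉ Z → q ∉ Z → Positionable G Z p q)

IsGpd : ∀ {n} (G : Graph n) (m : ℕ) → Set
IsGpd G m =
  Σ (Subset _) (λ Z → IsDualGP G Z × ∣ Z ∣ ≡ m) ×
  (∀ Z → IsDualGP G Z → ∣ Z ∣ ≤ m)

delete : ∀ {n} → Graph (suc n) → Fin (suc n) → Graph n
delete G x = record
  { Adj = λ i j → Adj G (punchIn x i) (punchIn x j)
  ; adj-sym = adj-sym G
  ; adj-irrefl = adj-irrefl G }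

-- T_k: vertex 0 = u, vertices 1..2k = v_1..v_2k, vertex 2k+1 = x
TEdge : (k : ℕ) → Fin (suc (suc (2 * k))) → Fin (suc (suc (2 * k))) → Set
TEdge k a b =
  (toℕ a ≡ 0 × 1 ≤ toℕ b × toℕ b ≤ 2 * k) ⊎
  (toℕ b ≡ suc (2 * k) × 1 ≤ toℕ a × toℕ a ≤ k)

private
  TEdge-irrefl : ∀ k a → ¬ TEdge k a a
  TEdge-irrefl k a (inj₁ (e , l , _)) with toℕ a
  TEdge-irrefl k a (inj₁ (refl , () , _)) | .0
  TEdge-irrefl k a (inj₂ (e , _ , h)) = hmm
    where
    big : k ≤ 2 * k
    big = m≤m+n k (k + 0)
    h2 : suc (2 * k) ≤ k
    h2 = subst (λ t → t ≤ k) e h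
    hmm : ⊥
    hmm = <-irrefl refl (≤-trans (s≤s big) h2)

T : (k : ℕ) → Graph (suc (suc (2 * k)))
T k = record
  { Adj = λ a b → TEdge k a b ⊎ TEdge k b a
  ; adj-sym = λ { (inj₁ e) → inj₂ e ; (inj₂ e) → inj₁ e }
  ; adj-irrefl = λ { (inj₁ e) → TEdge-irrefl k _ e ; (inj₂ e) → TEdge-irrefl k _ e } }

xT : (k : ℕ) → Fin (suc (suc (2 * k)))
xT k = fromℕ (suc (2 * k))

module Submission where

open import Defs
open import Data.Nat using (ℕ; zero; suc; _+_; _*_; _≤_; _<_; s≤s; z≤n; s≤s⁻¹; _≤?_)
open import Data.Nat.Properties
  using (≤-trans; <-irrefl; <-≤-trans; <⇒≢; <⇒≱; ≰⇒>; ≤∧≢⇒<; m≤n⇒m<n∨m≡n; m≤n*m; n≤1+n;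
         +-identityʳ; suc-injective; m+1+n≢0)
open import Data.Fin using (Fin; toℕ; fromℕ; punchIn; zero; suc)
open import Data.Fin.Properties using (toℕ-injective; toℕ-fromℕ; toℕ<n; punchIn-injective; punchInᵢ≢i)
open import Data.Fin.Subset using (Subset; _∈_; _∉_; ∣_∣; inside; outside; _⊆_; ⊤)
open import Data.Fin.Subset.Properties using (_∈?_; ∈⊤; ∣⊤∣≡n; ∣p∣≤n; ∣p∣≡n⇒p≡⊤; p⊆q⇒∣p∣≤∣q∣)
open import Data.Vec using ([]; _∷_; here; there)
open import Data.List.Relation.Unary.All using (tabulate; head)
open import Data.List.Relation.Unary.Any using (here; there)
open import Data.List.Membership.Propositional using () renaming (_∈_ to _∈ₗ_)
open import Data.Product using (∃; _×_; _,_)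
open import Data.Sum using (_⊎_; inj₁; inj₂)
open import Relation.Binary.PropositionalEquality using (_≡_; _≢_; refl; sym; trans; cong; subst)
open import Relation.Nullary using (¬_; yes; no)
open import Data.Empty using (⊥-elim)

-- A vertex with at most one neighbour is never an interior vertex of a shortest path,
-- so every set of such leaves is a dual general position set: {v_{k+1}, …, v_{2k}} in T_k,
-- and all 2k leaves of the star T_k − x. Conversely, if p and q are distinct, nonadjacent
-- and on the same side of Z, then no common neighbour of p and q lies in Z. Both u and x
-- are adjacent to the pairwise nonadjacent v₁, v₂, v₃, two of which lie on the same side,
-- so u, x ∉ Z; then each v_i with i ≤ k is a common neighbour of u and x, hence not in Z.
-- In the star, Z cannot contain every vertex, since u is a common neighbour of v₁ and v_{2k}.

AtMostOneNeighbour : ∀ {n} → Graph n → Fin n → Set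
AtMostOneNeighbour G r = ∀ {a b} → Adj G a r → Adj G b r → a ≡ b

Apart : ∀ {n} → Graph n → Fin n → Fin n → Set
Apart G p q = p ≢ q × ¬ Adj G p q

SameSide : ∀ {n} → Subset n → Fin n → Fin n → Set
SameSide Z p q = (p ∈ Z × q ∈ Z) ⊎ (p ∉ Z × q ∉ Z)

module _ {n : ℕ} {G : Graph n} where

  shortcut : ∀ {r p q} → AtMostOneNeighbour G r → (w : Walk G p q) → r ∈ₗ inner w →
             ∃ λ (w′ : Walk G p q) → len w′ < len w
  shortcut h (step e₁ (step e₂ w)) (here refl) with h e₁ (adj-sym G e₂)
  ... | refl = w , s≤s (n≤1+n _)
  shortcut h (step e₁ (step e₂ w)) (there r∈w) with shortcut h (step e₂ w) r∈w
  ... | w′ , w′<w = step e₁ w′ , s≤s w′<w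

  ∉inner-shortest : ∀ {r p q} {w : Walk G p q} → AtMostOneNeighbour G r → IsShortest w →
                    ¬ r ∈ₗ inner w
  ∉inner-shortest h shortest r∈w with shortcut h _ r∈w
  ... | w′ , w′<w = <⇒≱ w′<w (shortest w′)

  dualGP-of-leaves : ∀ {Z} → (∀ {r} → r ∈ Z → AtMostOneNeighbour G r) → IsDualGP G Z
  dualGP-of-leaves {Z} leaf = (λ p q _ _ → positionable p q) , (λ p q _ _ → positionable p q)
    where
    positionable : ∀ p q → Positionable G Z p q
    positionable p q w shortest = tabulate λ r∈w r∈Z → ∉inner-shortest (leaf r∈Z) shortest r∈w

  length-two-shortest : ∀ {p r q} → Apart G p q → (e₁ : Adj G p r) (e₂ : Adj G r q) →
                        IsShortest {G = G} (step e₁ (step e₂ here))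
  length-two-shortest (p≢q , _) _ _ here = ⊥-elim (p≢q refl)
  length-two-shortest (_ , ¬pq) _ _ (step pq here) = ⊥-elim (¬pq pq)
  length-two-shortest _ _ _ (step _ (step _ _)) = s≤s (s≤s z≤n)

  midpoint-∉ : ∀ {Z p r q} → Positionable G Z p q → Apart G p q → Adj G p r → Adj G r q → r ∉ Z
  midpoint-∉ pos apart e₁ e₂ = head (pos (step e₁ (step e₂ here)) (length-two-shortest apart e₁ e₂))

  sameSide-positionable : ∀ {Z p q} → IsDualGP G Z → SameSide Z p q → Positionable G Z p q
  sameSide-positionable (ins , _) (inj₁ (p∈Z , q∈Z)) = ins _ _ p∈Z q∈Z
  sameSide-positionable (_ , outs) (inj₂ (p∉Z , q∉Z)) = outs _ _ p∉Z q∉Z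

  two-on-same-side : ∀ (Z : Subset n) a b c → SameSide Z a b ⊎ SameSide Z a c ⊎ SameSide Z b c
  two-on-same-side Z a b c with a ∈? Z | b ∈? Z | c ∈? Z
  ... | yes a∈Z | yes b∈Z | _       = inj₁ (inj₁ (a∈Z , b∈Z))
  ... | no a∉Z  | no b∉Z  | _       = inj₁ (inj₂ (a∉Z , b∉Z))
  ... | yes a∈Z | no _    | yes c∈Z = inj₂ (inj₁ (inj₁ (a∈Z , c∈Z)))
  ... | no a∉Z  | yes _   | no c∉Z  = inj₂ (inj₁ (inj₂ (a∉Z , c∉Z)))
  ... | yes _   | no b∉Z  | no c∉Z  = inj₂ (inj₂ (inj₂ (b∉Z , c∉Z)))
  ... | no _    | yes b∈Z | yes c∈Z = inj₂ (inj₂ (inj₁ (b∈Z , c∈Z)))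

  claw-centre-∉ : ∀ {Z r a b c} → IsDualGP G Z → Adj G r a → Adj G r b → Adj G r c →
                  Apart G a b → Apart G a c → Apart G b c → r ∉ Z
  claw-centre-∉ {Z} {a = a} {b} {c} d ra rb rc ab ac bc with two-on-same-side Z a b c
  ... | inj₁ s        = midpoint-∉ (sameSide-positionable d s) ab (adj-sym G ra) rb
  ... | inj₂ (inj₁ s) = midpoint-∉ (sameSide-positionable d s) ac (adj-sym G ra) rc
  ... | inj₂ (inj₂ s) = midpoint-∉ (sameSide-positionable d s) bc (adj-sym G rb) rc

  ⊤-not-dualGP : ∀ {p r q} → Apart G p q → Adj G p r → Adj G r q → ¬ IsDualGP G ⊤
  ⊤-not-dualGP apart e₁ e₂ d = midpoint-∉ (sameSide-positionable d (inj₁ (∈⊤ , ∈⊤))) apart e₁ e₂ ∈⊤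

p≢⊤⇒∣p∣<n : ∀ {n} {p : Subset n} → p ≢ ⊤ → ∣ p ∣ < n
p≢⊤⇒∣p∣<n {p = p} p≢⊤ = ≤∧≢⇒< (∣p∣≤n p) (λ ∣p∣≡n → p≢⊤ (∣p∣≡n⇒p≡⊤ ∣p∣≡n))

toℕ≡⇒≡fromℕ : ∀ {n} {i : Fin (suc n)} → toℕ i ≡ n → i ≡ fromℕ n
toℕ≡⇒≡fromℕ {n} i≡n = toℕ-injective (trans i≡n (sym (toℕ-fromℕ n)))

interval : ℕ → ℕ → (n : ℕ) → Subset n
interval _       _       zero    = []
interval (suc a) b       (suc n) = outside ∷ interval a b n
interval zero    (suc b) (suc n) = inside ∷ interval zero b n
interval zero    zero    (suc n) = outside ∷ interval zero zero n

∈interval⇒bounds : ∀ a b n {i : Fin n} → i ∈ interval a b n → a ≤ toℕ i × toℕ i < a + b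
∈interval⇒bounds (suc a) b (suc n) {suc i} (there i∈) with ∈interval⇒bounds a b n i∈
... | a≤i , i<a+b = s≤s a≤i , s≤s i<a+b
∈interval⇒bounds zero (suc b) (suc n) {zero} here = z≤n , s≤s z≤n
∈interval⇒bounds zero (suc b) (suc n) {suc i} (there i∈) with ∈interval⇒bounds zero b n i∈
... | _ , i<b = z≤n , s≤s i<b
∈interval⇒bounds zero zero (suc n) {suc i} (there i∈) with ∈interval⇒bounds zero zero n i∈
... | _ , ()

bounds⇒∈interval : ∀ a b n {i : Fin n} → a ≤ toℕ i → toℕ i < a + b → i ∈ interval a b n
bounds⇒∈interval (suc a) b (suc n) {suc i} a≤i i<a+b =
  there (bounds⇒∈interval a b n (s≤s⁻¹ a≤i) (s≤s⁻¹ i<a+b))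
bounds⇒∈interval zero (suc b) (suc n) {zero} _ _ = here
bounds⇒∈interval zero (suc b) (suc n) {suc i} _ i<b =
  there (bounds⇒∈interval zero b n z≤n (s≤s⁻¹ i<b))

∣interval∣≡ : ∀ a b n → a + b ≤ n → ∣ interval a b n ∣ ≡ b
∣interval∣≡ zero    zero    zero    _ = refl
∣interval∣≡ (suc a) b       (suc n) a+b≤n = ∣interval∣≡ a b n (s≤s⁻¹ a+b≤n)
∣interval∣≡ zero    (suc b) (suc n) b≤n = cong suc (∣interval∣≡ zero b n (s≤s⁻¹ b≤n))
∣interval∣≡ zero    zero    (suc n) _ = ∣interval∣≡ zero zero n z≤n

LowLeaf OuterLeaf : ∀ k → Fin (suc (suc (2 * k))) → Set
LowLeaf   k j = 1 ≤ toℕ j × toℕ j ≤ k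
OuterLeaf k j = suc k ≤ toℕ j × toℕ j ≤ 2 * k

k≤2*k : ∀ k → k ≤ 2 * k
k≤2*k k = m≤n*m k 2

suc[k+k]≡suc[2*k] : ∀ k → suc k + k ≡ suc (2 * k)
suc[k+k]≡suc[2*k] k = cong (λ m → suc (k + m)) (sym (+-identityʳ k))

vertex-cases : ∀ k (i : Fin (suc (suc (2 * k)))) →
               i ≡ zero ⊎ LowLeaf k i ⊎ OuterLeaf k i ⊎ i ≡ xT k
vertex-cases k zero = inj₁ refl
vertex-cases k (suc j) with suc (toℕ j) ≤? k | m≤n⇒m<n∨m≡n (s≤s⁻¹ (toℕ<n j))
... | yes j<k | _          = inj₂ (inj₁ (s≤s z≤n , j<k))
... | no j≮k  | inj₁ j<2k  = inj₂ (inj₂ (inj₁ (≰⇒> j≮k , j<2k)))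
... | no _    | inj₂ j≡2k  = inj₂ (inj₂ (inj₂ (cong suc (toℕ≡⇒≡fromℕ j≡2k))))

centre-adj : ∀ k {j} → LowLeaf k j → Adj (T k) zero j
centre-adj k (1≤j , j≤k) = inj₁ (inj₁ (refl , 1≤j , ≤-trans j≤k (k≤2*k k)))

apex-adj : ∀ k {j} → LowLeaf k j → Adj (T k) (xT k) j
apex-adj k (1≤j , j≤k) = inj₂ (inj₂ (toℕ-fromℕ _ , 1≤j , j≤k))

centre-apex-apart : ∀ k → Apart (T k) zero (xT k)
centre-apex-apart k = (λ ()) , nonadjacent
  where
  nonadjacent : ¬ Adj (T k) zero (xT k)
  nonadjacent (inj₁ (inj₁ (_ , _ , x≤2k))) = <-irrefl refl (subst (_≤ 2 * k) (toℕ-fromℕ _) x≤2k)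
  nonadjacent (inj₁ (inj₂ (_ , () , _)))
  nonadjacent (inj₂ (inj₁ (() , _)))
  nonadjacent (inj₂ (inj₂ (() , _)))

low-leaves-nonadjacent : ∀ k {a b} → LowLeaf k a → LowLeaf k b → ¬ Adj (T k) a b
low-leaves-nonadjacent k (1≤a , _) _ (inj₁ (inj₁ (a≡0 , _))) = <⇒≢ 1≤a (sym a≡0)
low-leaves-nonadjacent k _ (_ , b≤k) (inj₁ (inj₂ (b≡x , _))) = <⇒≢ (s≤s (≤-trans b≤k (k≤2*k k))) b≡x
low-leaves-nonadjacent k _ (1≤b , _) (inj₂ (inj₁ (b≡0 , _))) = <⇒≢ 1≤b (sym b≡0)
low-leaves-nonadjacent k (_ , a≤k) _ (inj₂ (inj₂ (a≡x , _))) = <⇒≢ (s≤s (≤-trans a≤k (k≤2*k k))) a≡x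

outer-leaf-neighbour : ∀ k {a r} → OuterLeaf k r → Adj (T k) a r → a ≡ zero
outer-leaf-neighbour k _ (inj₁ (inj₁ (a≡0 , _))) = toℕ-injective a≡0
outer-leaf-neighbour k (_ , r≤2k) (inj₁ (inj₂ (r≡x , _))) = ⊥-elim (<⇒≢ (s≤s r≤2k) r≡x)
outer-leaf-neighbour k (k<r , _) (inj₂ (inj₁ (r≡0 , _))) =
  ⊥-elim (<⇒≢ (<-≤-trans (s≤s z≤n) k<r) (sym r≡0))
outer-leaf-neighbour k (k<r , _) (inj₂ (inj₂ (_ , _ , r≤k))) = ⊥-elim (<⇒≱ k<r r≤k)

leaf-neighbour : ∀ k {a r} → r ≢ zero → r ≢ xT k → Adj (T k) a r → a ≡ zero ⊎ a ≡ xT k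
leaf-neighbour k _ _ (inj₁ (inj₁ (a≡0 , _))) = inj₁ (toℕ-injective a≡0)
leaf-neighbour k _ r≢x (inj₁ (inj₂ (r≡x , _))) = ⊥-elim (r≢x (toℕ≡⇒≡fromℕ r≡x))
leaf-neighbour k r≢0 _ (inj₂ (inj₁ (r≡0 , _))) = ⊥-elim (r≢0 (toℕ-injective r≡0))
leaf-neighbour k _ _ (inj₂ (inj₂ (a≡x , _))) = inj₂ (toℕ≡⇒≡fromℕ a≡x)

outerLeaves : ∀ k → Subset (suc (suc (2 * k)))
outerLeaves k = interval (suc k) k _

∈outerLeaves⇒OuterLeaf : ∀ k {i} → i ∈ outerLeaves k → OuterLeaf k i
∈outerLeaves⇒OuterLeaf k {i} i∈ with ∈interval⇒bounds (suc k) k _ i∈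
... | k<i , i<k+1+k = k<i , s≤s⁻¹ (subst (toℕ i <_) (suc[k+k]≡suc[2*k] k) i<k+1+k)

OuterLeaf⇒∈outerLeaves : ∀ k {i} → OuterLeaf k i → i ∈ outerLeaves k
OuterLeaf⇒∈outerLeaves k {i} (k<i , i≤2k) =
  bounds⇒∈interval (suc k) k _ k<i (subst (toℕ i <_) (sym (suc[k+k]≡suc[2*k] k)) (s≤s i≤2k))

∣outerLeaves∣≡k : ∀ k → ∣ outerLeaves k ∣ ≡ k
∣outerLeaves∣≡k k =
  ∣interval∣≡ (suc k) k _ (subst (_≤ suc (suc (2 * k))) (sym (suc[k+k]≡suc[2*k] k)) (n≤1+n _))

outerLeaves-dualGP : ∀ k → IsDualGP (T k) (outerLeaves k)
outerLeaves-dualGP k = dualGP-of-leaves λ i∈ ea eb →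
  trans (outer-leaf-neighbour k (∈outerLeaves⇒OuterLeaf k i∈) ea)
        (sym (outer-leaf-neighbour k (∈outerLeaves⇒OuterLeaf k i∈) eb))

centre-apex-∉ : ∀ {k Z} → 3 ≤ k → IsDualGP (T k) Z → zero ∉ Z × xT k ∉ Z
centre-apex-∉ {k} {Z} (s≤s (s≤s (s≤s _))) d =
  claw-of-low-leaves (centre-adj k) , claw-of-low-leaves (apex-adj k)
  where
  v₁ : LowLeaf k (suc zero)
  v₁ = s≤s z≤n , s≤s z≤n
  v₂ : LowLeaf k (suc (suc zero))
  v₂ = s≤s z≤n , s≤s (s≤s z≤n)
  v₃ : LowLeaf k (suc (suc (suc zero)))
  v₃ = s≤s z≤n , s≤s (s≤s (s≤s z≤n))
  claw-of-low-leaves : ∀ {r} → (∀ {j} → LowLeaf k j → Adj (T k) r j) → r ∉ Z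
  claw-of-low-leaves r-adj = claw-centre-∉ d (r-adj v₁) (r-adj v₂) (r-adj v₃)
    ((λ ()) , low-leaves-nonadjacent k v₁ v₂)
    ((λ ()) , low-leaves-nonadjacent k v₁ v₃)
    ((λ ()) , low-leaves-nonadjacent k v₂ v₃)

dualGP⊆outerLeaves : ∀ {k Z} → 3 ≤ k → IsDualGP (T k) Z → Z ⊆ outerLeaves k
dualGP⊆outerLeaves {k} 3≤k d {i} i∈Z with centre-apex-∉ 3≤k d | vertex-cases k i
... | u∉Z , _   | inj₁ refl                = ⊥-elim (u∉Z i∈Z)
... | u∉Z , x∉Z | inj₂ (inj₁ low)          = ⊥-elim (midpoint-∉
  (sameSide-positionable d (inj₂ (u∉Z , x∉Z))) (centre-apex-apart k)
  (centre-adj k low) (adj-sym (T k) (apex-adj k low)) i∈Z)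
... | _         | inj₂ (inj₂ (inj₁ outer)) = OuterLeaf⇒∈outerLeaves k outer
... | _ , x∉Z   | inj₂ (inj₂ (inj₂ refl))  = ⊥-elim (x∉Z i∈Z)

star : ∀ k → Graph (suc (2 * k))
star k = delete (T k) (xT k)

toℕ-punchIn-fromℕ : ∀ {n} (i : Fin n) → toℕ (punchIn (fromℕ n) i) ≡ toℕ i
toℕ-punchIn-fromℕ zero    = refl
toℕ-punchIn-fromℕ (suc i) = cong suc (toℕ-punchIn-fromℕ i)

star-centre-adj : ∀ k (r : Fin (2 * k)) → Adj (star k) zero (suc r)
star-centre-adj k r =
  inj₁ (inj₁ (refl , s≤s z≤n , subst (_< 2 * k) (sym (toℕ-punchIn-fromℕ r)) (toℕ<n r)))

star-leaf-neighbour : ∀ k {a} (r : Fin (2 * k)) → Adj (star k) a (suc r) → a ≡ zero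
star-leaf-neighbour k {a} r e with leaf-neighbour k (λ ()) (punchInᵢ≢i (xT k) (suc r)) e
... | inj₁ a≡u = punchIn-injective (xT k) a zero a≡u
... | inj₂ a≡x = ⊥-elim (punchInᵢ≢i (xT k) a a≡x)

leaves-dualGP : ∀ k → IsDualGP (star k) (outside ∷ ⊤)
leaves-dualGP k = dualGP-of-leaves λ { {suc r} _ ea eb →
  trans (star-leaf-neighbour k r ea) (sym (star-leaf-neighbour k r eb)) }

star-not-⊤-dualGP : ∀ k → 1 ≤ k → ¬ IsDualGP (star k) ⊤
star-not-⊤-dualGP (suc k) _ =
  ⊤-not-dualGP {p = v₁} {q = v₂} (v₁≢v₂ , v₁≁v₂)
    (adj-sym (star (suc k)) {zero} {v₁} (star-centre-adj _ zero)) (star-centre-adj _ _)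
  where
  v₁ v₂ : Fin (suc (2 * suc k))
  v₁ = suc zero
  v₂ = fromℕ (2 * suc k)
  v₁≢v₂ : v₁ ≢ v₂
  v₁≢v₂ eq = m+1+n≢0 k (sym (suc-injective (trans (cong toℕ eq) (toℕ-fromℕ _))))
  v₁≁v₂ : ¬ Adj (star (suc k)) v₁ v₂
  v₁≁v₂ e with star-leaf-neighbour (suc k) {v₁} _ e
  ... | ()

gpd-T : ∀ k → 3 ≤ k → IsGpd (T k) k
gpd-T k 3≤k =
    (outerLeaves k , outerLeaves-dualGP k , ∣outerLeaves∣≡k k)
  , λ Z d → subst (∣ Z ∣ ≤_) (∣outerLeaves∣≡k k) (p⊆q⇒∣p∣≤∣q∣ (dualGP⊆outerLeaves 3≤k d))

gpd-star : ∀ k → 1 ≤ k → IsGpd (star k) (2 * k)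
gpd-star k 1≤k =
    (outside ∷ ⊤ , leaves-dualGP k , ∣⊤∣≡n (2 * k))
  , λ Z d → s≤s⁻¹ (p≢⊤⇒∣p∣<n {p = Z} λ { refl → star-not-⊤-dualGP k 1≤k d })

proposition3p7 : (k : ℕ) → 3 ≤ k →
    IsGpd (T k) k × IsGpd (delete (T k) (xT k)) (2 * k)
proposition3p7 k 3≤k = gpd-T k 3≤k , gpd-star k (≤-trans (s≤s z≤n) 3≤k)
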